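{- CTL*CD is strictly more expressive than CTL*, and CTL*CD is incomparable in expressive power with the modal $\mu$-calculus. More precisely: every CTL* state formula is equivalent to a CTL*CD state formula, but there is a CTL*CD state formula equivalent to no CTL* state formula; there is a CTL*CD state formula equivalent to no $\mu$-calculus formula; and there is a $\mu$-calculus formula equivalent to no CTL*CD state formula.
   Context: A Kripke structure over a finite set $AP$ is $K=(AP,W,R,L,w_I)$ with $W$ a countable non-empty set, $w_I\in W$, $R\subseteq W\times W$ left-total, $L:W\to 2^{AP}$. A path is an infinite sequence $\pi$ of worlds with $(\pi_i,\pi_{i+1})\in R$ for all $i$; it is a cycle if for every $i$ there is $j>i$ with $\pi_j=\pi_0$; $\mathrm{Pth}(w)$, $\mathrm{Cyc}(w)$ are the paths, resp. cycles, with $\pi_0=w$. CTL*CD: state formulas $\phi ::= p \mid \neg\phi\mid\phi\wedge\phi\mid\phi\vee\phi\mid \mathsf E\psi\mid\mathsf A\psi\mid \mathsf E^{\circlearrowleft}\psi\mid\mathsf A^{\circlearrowleft}\psi$, path formulas $\psi::=\phi\mid\neg\psi\mid\psi\wedge\psi\mid\psi\vee\psi\mid \mathsf X\psi\mid\psi\,\mathsf U\,\psi$; $K,w\models p$ iff $p\in L(w)$; Boolean connectives usual; $\mathsf E\psi$/$\mathsf A\psi$: some/every $\pi\in\mathrm{Pth}(w)$ has $K,\pi,0\models\psi$; $\mathsf E^{\circlearrowleft}\psi$/$\mathsf A^{\circlearrowleft}\psi$: some/every $\pi\in\mathrm{Cyc}(w)$ has $K,\pi,0\models\psi$; $K,\pi,i\models\phi$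 iff $K,\pi_i\models\phi$; $K,\pi,i\models\mathsf X\psi$ iff $K,\pi,i+1\models\psi$; $K,\pi,i\models\psi_1\mathsf U\psi_2$ iff some $k$ has $K,\pi,i+k\models\psi_2$ and $K,\pi,i+j\models\psi_1$ for all $0\le j<k$. $K\models\phi$ iff $K,w_I\models\phi$. CTL* is the fragment of CTL*CD without $\mathsf E^{\circlearrowleft},\mathsf A^{\circlearrowleft}$. The modal $\mu$-calculus is the standard fixpoint logic over Kripke structures, evaluated at $w_I$. Two formulas (possibly of different logics) are equivalent if they hold in exactly the same Kripke structures. Logic $\mathcal L_1$ is at least as expressive as $\mathcal L_2$ if every $\mathcal L_2$ formula is equivalent to some $\mathcal L_1$ formula; strictly more expressive if moreover the converse fails; incomparable if neither is at least as expressive as the other. -}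

module Defs where

open import Level using (Lift; lift) renaming (suc to lsuc; zero to lzero)
open import Data.Nat using (ℕ; zero; suc; _<_; _+_)
open import Data.Fin using (Fin; zero; suc)
open import Data.Bool using (Bool; true)
open import Data.Product using (Σ; _×_; _,_)
open import Data.Sum using (_⊎_)
open import Data.Unit using (⊤)
open import Data.Empty using (⊥)
open import Relation.Nullary using (¬_)
open import Relation.Binary.PropositionalEquality using (_≡_)
open import Function.Bundles using (_⇔_)

-- Kripke structures over AP = Fin n (a finite set of atomic propositions)

record Kripke (n : ℕ) : Set₁ where
  field
    W       : Set
    R       : W → W → Set
    L       : W → Fin n → Bool
    wI      : W                        -- initial world (so W is non-empty)
    enc     : W → ℕ                    -- W is countable:
    enc-inj : ∀ x y → enc x ≡ enc y → x ≡ y   -- an injection into ℕ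
    total   : ∀ w → Σ W (λ v → R w v)

open Kripke

IsPath : ∀ {n} (K : Kripke n) → (ℕ → W K) → Set
IsPath K π = ∀ i → R K (π i) (π (suc i))

IsCycle : ∀ {n} (K : Kripke n) → (ℕ → W K) → Set
IsCycle K π = ∀ i → Σ ℕ (λ j → (i < j) × (π j ≡ π 0))

mutual
  data SF (n : ℕ) : Set where
    atom  : Fin n → SF n
    ¬ₛ_   : SF n → SF n
    _∧ₛ_  : SF n → SF n → SF n
    _∨ₛ_  : SF n → SF n → SF n
    E     : PF n → SF n
    A     : PF n → SF n
    Ec    : PF n → SF n
    Ac    : PF n → SF n

  data PF (n : ℕ) : Set where
    st    : SF n → PF n
    ¬ₚ_   : PF n → PF n
    _∧ₚ_  : PF n → PF n → PF n
    _∨ₚ_  : PF n → PF n → PF n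
    X     : PF n → PF n
    _U_   : PF n → PF n → PF n

mutual
  IsCTL*ₛ : ∀ {n} → SF n → Set
  IsCTL*ₛ (atom p)  = ⊤
  IsCTL*ₛ (¬ₛ φ)    = IsCTL*ₛ φ
  IsCTL*ₛ (φ ∧ₛ ψ)  = IsCTL*ₛ φ × IsCTL*ₛ ψ
  IsCTL*ₛ (φ ∨ₛ ψ)  = IsCTL*ₛ φ × IsCTL*ₛ ψ
  IsCTL*ₛ (E ψ)     = IsCTL*ₚ ψ
  IsCTL*ₛ (A ψ)     = IsCTL*ₚ ψ
  IsCTL*ₛ (Ec ψ)    = ⊥
  IsCTL*ₛ (Ac ψ)    = ⊥

  IsCTL*ₚ : ∀ {n} → PF n → Set
  IsCTL*ₚ (st φ)    = IsCTL*ₛ φ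
  IsCTL*ₚ (¬ₚ ψ)    = IsCTL*ₚ ψ
  IsCTL*ₚ (ψ ∧ₚ χ)  = IsCTL*ₚ ψ × IsCTL*ₚ χ
  IsCTL*ₚ (ψ ∨ₚ χ)  = IsCTL*ₚ ψ × IsCTL*ₚ χ
  IsCTL*ₚ (X ψ)     = IsCTL*ₚ ψ
  IsCTL*ₚ (ψ U χ)   = IsCTL*ₚ ψ × IsCTL*ₚ χ

mutual
  satS : ∀ {n} (K : Kripke n) → W K → SF n → Set
  satS K w (atom p) = L K w p ≡ true
  satS K w (¬ₛ φ)   = ¬ satS K w φ
  satS K w (φ ∧ₛ ψ) = satS K w φ × satS K w ψ
  satS K w (φ ∨ₛ ψ) = satS K w φ ⊎ satS K w ψ
  satS K w (E ψ)    = Σ (ℕ → W K) λ π → (π 0 ≡ w) × IsPath K π × satP K π 0 ψ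
  satS K w (A ψ)    = (π : ℕ → W K) → π 0 ≡ w → IsPath K π → satP K π 0 ψ
  satS K w (Ec ψ)   = Σ (ℕ → W K) λ π → (π 0 ≡ w) × IsPath K π × IsCycle K π × satP K π 0 ψ
  satS K w (Ac ψ)   = (π : ℕ → W K) → π 0 ≡ w → IsPath K π → IsCycle K π → satP K π 0 ψ

  satP : ∀ {n} (K : Kripke n) → (ℕ → W K) → ℕ → PF n → Set
  satP K π i (st φ)   = satS K (π i) φ
  satP K π i (¬ₚ ψ)   = ¬ satP K π i ψ
  satP K π i (ψ ∧ₚ χ) = satP K π i ψ × satP K π i χ
  satP K π i (ψ ∨ₚ χ) = satP K π i ψ ⊎ satP K π i χ
  satP K π i (X ψ)    = satP K π (suc i) ψ
  satP K π i (ψ U χ)  = Σ ℕ λ k → satP K π (i + k) χ × (∀ j → j < k → satP K π (i + j) ψ)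

_⊨_ : ∀ {n} → Kripke n → SF n → Set
K ⊨ φ = satS K (wI K) φ

-- Modal μ-calculus in positive normal form, variables as de Bruijn
-- indices Fin m; sentences are MuF n 0.

data MuF (n : ℕ) : ℕ → Set where
  atom  : ∀ {m} → Fin n → MuF n m
  natom : ∀ {m} → Fin n → MuF n m
  var   : ∀ {m} → Fin m → MuF n m
  _∧μ_  : ∀ {m} → MuF n m → MuF n m → MuF n m
  _∨μ_  : ∀ {m} → MuF n m → MuF n m → MuF n m
  dia   : ∀ {m} → MuF n m → MuF n m
  box   : ∀ {m} → MuF n m → MuF n m
  μ     : ∀ {m} → MuF n (suc m) → MuF n m
  ν     : ∀ {m} → MuF n (suc m) → MuF n m

extend : ∀ {m} {B : Set₁} → B → (Fin m → B) → Fin (suc m) → B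
extend S ρ zero    = S
extend S ρ (suc i) = ρ i

-- sets of worlds are predicates W → Set; μ = intersection of all
-- prefixed points, ν = union of all postfixed points (Knaster–Tarski).
⟦_⟧ : ∀ {n m} → MuF n m → (K : Kripke n) → (Fin m → W K → Set) → W K → Set₁
⟦ atom p ⟧  K ρ w = Lift (lsuc lzero) (L K w p ≡ true)
⟦ natom p ⟧ K ρ w = Lift (lsuc lzero) (¬ (L K w p ≡ true))
⟦ var x ⟧   K ρ w = Lift (lsuc lzero) (ρ x w)
⟦ φ ∧μ ψ ⟧  K ρ w = ⟦ φ ⟧ K ρ w × ⟦ ψ ⟧ K ρ w
⟦ φ ∨μ ψ ⟧  K ρ w = ⟦ φ ⟧ K ρ w ⊎ ⟦ ψ ⟧ K ρ w
⟦ dia φ ⟧   K ρ w = Σ (W K) λ v → Lift (lsuc lzero) (R K w v) × ⟦ φ ⟧ K ρ v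
⟦ box φ ⟧   K ρ w = (v : W K) → R K w v → ⟦ φ ⟧ K ρ v
⟦ μ φ ⟧     K ρ w = (S : W K → Set) → (∀ v → ⟦ φ ⟧ K (extend S ρ) v → Lift (lsuc lzero) (S v)) → Lift (lsuc lzero) (S w)
⟦ ν φ ⟧     K ρ w = Σ (W K → Set) λ S → (∀ v → S v → ⟦ φ ⟧ K (extend S ρ) v) × Lift (lsuc lzero) (S w)

_⊨μ_ : ∀ {n} → Kripke n → MuF n 0 → Set₁
K ⊨μ χ = ⟦ χ ⟧ K (λ ()) (wI K)

Equiv : ∀ {n} → SF n → SF n → Set₁
Equiv φ ψ = (K : Kripke _) → (K ⊨ φ) ⇔ (K ⊨ ψ)

EquivMu : ∀ {n} → SF n → MuF n 0 → Set₁
EquivMu φ χ = (K : Kripke _) → (K ⊨ φ) ⇔ (K ⊨μ χ)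

-- CTL* and the μ-calculus are invariant under bisimulation, while the cycle quantifiers are
-- not: the one-world loop and the infinite line are bisimilar, but only the loop has a cycle.
-- Conversely, on the countdown structure (each world steps to its predecessor, 0 loops on
-- itself, p holds exactly at 0) a CTL*CD formula with X-nesting depth d cannot tell apart
-- two worlds above d: cycles exist only at 0, and an until evaluated from either world meets
-- the same worlds ≤ d in the same order, preceded only by worlds above d.  The μ-calculus
-- sentence "0 is at even distance" separates 2d+2 from 2d+3.

module Submission where

open import Level using (Lift; lift; lower)
open import Data.Nat
open import Data.Nat.Properties
open import Data.Fin using (Fin; zero; suc)
open import Data.Bool using (Bool; true; false)
open import Data.Unit using (⊤; tt)
open import Data.Empty using (⊥-elim)
open import Data.Sum using (_⊎_; inj₁; inj₂)
open import Data.Product using (Σ; _×_; _,_; proj₁; proj₂)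
open import Relation.Nullary using (¬_; yes; no)
open import Relation.Binary.PropositionalEquality
open import Function.Bundles using (Equivalence)
open import Function.Properties.Equivalence using () renaming (refl to ⇔-refl)

open import Defs
open Kripke

private variable
  n : ℕ
  K₁ K₂ : Kripke n

preserved⇒¬Equiv : {φ ψ : SF n} → K₁ ⊨ φ → ¬ K₂ ⊨ φ → (K₁ ⊨ ψ → K₂ ⊨ ψ) → ¬ Equiv φ ψ
preserved⇒¬Equiv {K₁ = K₁} {K₂} K₁⊨φ K₂⊭φ preserve φ≡ψ =
  K₂⊭φ (Equivalence.from (φ≡ψ K₂) (preserve (Equivalence.to (φ≡ψ K₁) K₁⊨φ)))

preserved⇒¬EquivMu : {φ : SF n} {χ : MuF n 0} →
                     K₁ ⊨ φ → ¬ K₂ ⊨ φ → (K₁ ⊨μ χ → K₂ ⊨μ χ) → ¬ EquivMu φ χ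
preserved⇒¬EquivMu {K₁ = K₁} {K₂} K₁⊨φ K₂⊭φ preserve φ≡χ =
  K₂⊭φ (Equivalence.from (φ≡χ K₂) (preserve (Equivalence.to (φ≡χ K₁) K₁⊨φ)))

preservedMu⇒¬EquivMu : {φ : SF n} {χ : MuF n 0} →
                       K₁ ⊨μ χ → ¬ K₂ ⊨μ χ → (K₁ ⊨ φ → K₂ ⊨ φ) → ¬ EquivMu φ χ
preservedMu⇒¬EquivMu {K₁ = K₁} {K₂} K₁⊨χ K₂⊭χ preserve φ≡χ =
  K₂⊭χ (Equivalence.to (φ≡χ K₂) (preserve (Equivalence.from (φ≡χ K₁) K₁⊨χ)))

record Bisim (K₁ K₂ : Kripke n) : Set₁ where
  field
    _∼_   : W K₁ → W K₂ → Set
    zig   : ∀ {w₁ w₂ v₁} → w₁ ∼ w₂ → R K₁ w₁ v₁ → Σ (W K₂) λ v₂ → R K₂ w₂ v₂ × v₁ ∼ v₂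
    zag   : ∀ {w₁ w₂ v₂} → w₁ ∼ w₂ → R K₂ w₂ v₂ → Σ (W K₁) λ v₁ → R K₁ w₁ v₁ × v₁ ∼ v₂
    label : ∀ {w₁ w₂} → w₁ ∼ w₂ → ∀ p → L K₁ w₁ p ≡ L K₂ w₂ p

open Bisim

converse : Bisim K₁ K₂ → Bisim K₂ K₁
converse B = record
  { _∼_   = λ w₂ w₁ → _∼_ B w₁ w₂
  ; zig   = zag B
  ; zag   = zig B
  ; label = λ w₁∼w₂ p → sym (label B w₁∼w₂ p)
  }

liftPath : (B : Bisim K₁ K₂) (π : ℕ → W K₁) → IsPath K₁ π → ∀ {w₂} → _∼_ B (π 0) w₂ →
           Σ (ℕ → W K₂) λ π′ → π′ 0 ≡ w₂ × IsPath K₂ π′ × (∀ i → _∼_ B (π i) (π′ i))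
liftPath {K₂ = K₂} B π path {w₂} π₀∼w₂ =
  (λ i → proj₁ (track i)) , refl , step , (λ i → proj₂ (track i))
  where
  track : (i : ℕ) → Σ (W K₂) (_∼_ B (π i))
  step  : (i : ℕ) → R K₂ (proj₁ (track i)) (proj₁ (track (suc i)))
  track zero    = w₂ , π₀∼w₂
  track (suc i) = let v , _ , πᵢ₊₁∼v = zig B (proj₂ (track i)) (path i) in v , πᵢ₊₁∼v
  step i = proj₁ (proj₂ (zig B (proj₂ (track i)) (path i)))

mutual
  ctl*-bisim-invariantₛ : (B : Bisim K₁ K₂) (φ : SF n) → IsCTL*ₛ φ →
                          ∀ {w₁ w₂} → _∼_ B w₁ w₂ → satS K₁ w₁ φ → satS K₂ w₂ φ
  ctl*-bisim-invariantₛ B (atom p) _ w₁∼w₂ h = trans (sym (label B w₁∼w₂ p)) h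
  ctl*-bisim-invariantₛ B (¬ₛ φ) c w₁∼w₂ h h′ =
    h (ctl*-bisim-invariantₛ (converse B) φ c w₁∼w₂ h′)
  ctl*-bisim-invariantₛ B (φ ∧ₛ ψ) (c , c′) w₁∼w₂ (h , h′) =
    ctl*-bisim-invariantₛ B φ c w₁∼w₂ h , ctl*-bisim-invariantₛ B ψ c′ w₁∼w₂ h′
  ctl*-bisim-invariantₛ B (φ ∨ₛ ψ) (c , c′) w₁∼w₂ (inj₁ h) =
    inj₁ (ctl*-bisim-invariantₛ B φ c w₁∼w₂ h)
  ctl*-bisim-invariantₛ B (φ ∨ₛ ψ) (c , c′) w₁∼w₂ (inj₂ h) =
    inj₂ (ctl*-bisim-invariantₛ B ψ c′ w₁∼w₂ h)
  ctl*-bisim-invariantₛ B (E ψ) c w₁∼w₂ (π , refl , path , h) =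
    let π′ , π′₀ , path′ , π∼π′ = liftPath B π path w₁∼w₂
    in π′ , π′₀ , path′ , ctl*-bisim-invariantₚ B ψ c π∼π′ 0 h
  ctl*-bisim-invariantₛ B (A ψ) c w₁∼w₂ h π′ refl path′ =
    let π , π₀ , path , π′∼π = liftPath (converse B) π′ path′ w₁∼w₂
    in ctl*-bisim-invariantₚ B ψ c π′∼π 0 (h π π₀ path)
  ctl*-bisim-invariantₛ B (Ec ψ) ()
  ctl*-bisim-invariantₛ B (Ac ψ) ()

  ctl*-bisim-invariantₚ : (B : Bisim K₁ K₂) (ψ : PF n) → IsCTL*ₚ ψ →
                          ∀ {π₁ π₂} → (∀ i → _∼_ B (π₁ i) (π₂ i)) →
                          ∀ i → satP K₁ π₁ i ψ → satP K₂ π₂ i ψ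
  ctl*-bisim-invariantₚ B (st φ) c π₁∼π₂ i h = ctl*-bisim-invariantₛ B φ c (π₁∼π₂ i) h
  ctl*-bisim-invariantₚ B (¬ₚ ψ) c π₁∼π₂ i h h′ =
    h (ctl*-bisim-invariantₚ (converse B) ψ c π₁∼π₂ i h′)
  ctl*-bisim-invariantₚ B (ψ ∧ₚ χ) (c , c′) π₁∼π₂ i (h , h′) =
    ctl*-bisim-invariantₚ B ψ c π₁∼π₂ i h , ctl*-bisim-invariantₚ B χ c′ π₁∼π₂ i h′
  ctl*-bisim-invariantₚ B (ψ ∨ₚ χ) (c , c′) π₁∼π₂ i (inj₁ h) =
    inj₁ (ctl*-bisim-invariantₚ B ψ c π₁∼π₂ i h)
  ctl*-bisim-invariantₚ B (ψ ∨ₚ χ) (c , c′) π₁∼π₂ i (inj₂ h) =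
    inj₂ (ctl*-bisim-invariantₚ B χ c′ π₁∼π₂ i h)
  ctl*-bisim-invariantₚ B (X ψ) c π₁∼π₂ i h = ctl*-bisim-invariantₚ B ψ c π₁∼π₂ (suc i) h
  ctl*-bisim-invariantₚ B (ψ U χ) (c , c′) π₁∼π₂ i (k , h , before) =
    k , ctl*-bisim-invariantₚ B χ c′ π₁∼π₂ (i + k) h
      , λ j j<k → ctl*-bisim-invariantₚ B ψ c π₁∼π₂ (i + j) (before j j<k)

module _ {K₁ K₂ : Kripke n} (B : Bisim K₁ K₂) where

  RelatedEnv : ∀ {m} → (Fin m → W K₁ → Set) → (Fin m → W K₂ → Set) → Set
  RelatedEnv ρ₁ ρ₂ = ∀ x {w₁ w₂} → _∼_ B w₁ w₂ → ρ₁ x w₁ → ρ₂ x w₂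

  extend-related : ∀ {m} {ρ₁ ρ₂} {S₁ : W K₁ → Set} {S₂ : W K₂ → Set} → RelatedEnv {m} ρ₁ ρ₂ →
                   (∀ {w₁ w₂} → _∼_ B w₁ w₂ → S₁ w₁ → S₂ w₂) →
                   RelatedEnv (extend S₁ ρ₁) (extend S₂ ρ₂)
  extend-related ρ₁∼ρ₂ S₁∼S₂ zero    = S₁∼S₂
  extend-related ρ₁∼ρ₂ S₁∼S₂ (suc x) = ρ₁∼ρ₂ x

  μ-bisim-invariant : ∀ {m} (χ : MuF n m) {ρ₁ ρ₂} → RelatedEnv ρ₁ ρ₂ →
                      ∀ {w₁ w₂} → _∼_ B w₁ w₂ → ⟦ χ ⟧ K₁ ρ₁ w₁ → ⟦ χ ⟧ K₂ ρ₂ w₂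
  μ-bisim-invariant (atom p)  ρ₁∼ρ₂ w₁∼w₂ (lift h) = lift (trans (sym (label B w₁∼w₂ p)) h)
  μ-bisim-invariant (natom p) ρ₁∼ρ₂ w₁∼w₂ (lift h) = lift (λ h′ → h (trans (label B w₁∼w₂ p) h′))
  μ-bisim-invariant (var x)   ρ₁∼ρ₂ w₁∼w₂ (lift h) = lift (ρ₁∼ρ₂ x w₁∼w₂ h)
  μ-bisim-invariant (χ ∧μ χ′) ρ₁∼ρ₂ w₁∼w₂ (h , h′) =
    μ-bisim-invariant χ ρ₁∼ρ₂ w₁∼w₂ h , μ-bisim-invariant χ′ ρ₁∼ρ₂ w₁∼w₂ h′
  μ-bisim-invariant (χ ∨μ χ′) ρ₁∼ρ₂ w₁∼w₂ (inj₁ h) = inj₁ (μ-bisim-invariant χ ρ₁∼ρ₂ w₁∼w₂ h)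
  μ-bisim-invariant (χ ∨μ χ′) ρ₁∼ρ₂ w₁∼w₂ (inj₂ h) = inj₂ (μ-bisim-invariant χ′ ρ₁∼ρ₂ w₁∼w₂ h)
  μ-bisim-invariant (dia χ) ρ₁∼ρ₂ w₁∼w₂ (v₁ , lift r₁ , h) =
    let v₂ , r₂ , v₁∼v₂ = zig B w₁∼w₂ r₁
    in v₂ , lift r₂ , μ-bisim-invariant χ ρ₁∼ρ₂ v₁∼v₂ h
  μ-bisim-invariant (box χ) ρ₁∼ρ₂ w₁∼w₂ h v₂ r₂ =
    let v₁ , r₁ , v₁∼v₂ = zag B w₁∼w₂ r₂
    in μ-bisim-invariant χ ρ₁∼ρ₂ v₁∼v₂ (h v₁ r₁)
  -- The pullback of a prefixed point S₂ along the bisimulation is a prefixed point in K₁.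
  μ-bisim-invariant (μ χ) {ρ₁} {ρ₂} ρ₁∼ρ₂ {w₁} {w₂} w₁∼w₂ h S₂ prefixed₂ =
    lift (lower (h S₁ prefixed₁) w₂ w₁∼w₂)
    where
    S₁ : W K₁ → Set
    S₁ v₁ = ∀ v₂ → _∼_ B v₁ v₂ → S₂ v₂
    prefixed₁ : ∀ v₁ → ⟦ χ ⟧ K₁ (extend S₁ ρ₁) v₁ → Lift _ (S₁ v₁)
    prefixed₁ v₁ h′ = lift λ v₂ v₁∼v₂ → lower (prefixed₂ v₂
      (μ-bisim-invariant χ (extend-related ρ₁∼ρ₂ (λ {_} {v₂} v₁∼v₂ s₁ → s₁ v₂ v₁∼v₂)) v₁∼v₂ h′))
  -- The image of a postfixed point S₁ along the bisimulation is a postfixed point in K₂.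
  μ-bisim-invariant (ν χ) {ρ₁} {ρ₂} ρ₁∼ρ₂ {w₁} {w₂} w₁∼w₂ (S₁ , postfixed₁ , lift s₁) =
    S₂ , postfixed₂ , lift (w₁ , w₁∼w₂ , s₁)
    where
    S₂ : W K₂ → Set
    S₂ v₂ = Σ (W K₁) λ v₁ → _∼_ B v₁ v₂ × S₁ v₁
    postfixed₂ : ∀ v₂ → S₂ v₂ → ⟦ χ ⟧ K₂ (extend S₂ ρ₂) v₂
    postfixed₂ v₂ (v₁ , v₁∼v₂ , s) =
      μ-bisim-invariant χ (extend-related ρ₁∼ρ₂ (λ {v₁} v₁∼v₂ s₁ → v₁ , v₁∼v₂ , s₁)) v₁∼v₂
        (postfixed₁ v₁ s)

loop : Kripke n
loop = record
  { W = ⊤ ; R = λ _ _ → ⊤ ; L = λ _ _ → true ; wI = tt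
  ; enc = λ _ → 0 ; enc-inj = λ _ _ _ → refl ; total = λ _ → tt , tt }

line : Kripke n
line = record
  { W = ℕ ; R = λ a b → b ≡ suc a ; L = λ _ _ → true ; wI = 0
  ; enc = λ a → a ; enc-inj = λ _ _ e → e ; total = λ a → suc a , refl }

loop∼line : Bisim (loop {n}) line
loop∼line = record
  { _∼_ = λ _ _ → ⊤
  ; zig = λ {_} {a} _ _ → suc a , refl , tt
  ; zag = λ _ _ → tt , tt , tt
  ; label = λ _ _ → refl
  }

line-path : ∀ {n} (π : ℕ → ℕ) → IsPath (line {n}) π → ∀ k → π k ≡ π 0 + k
line-path     π path zero    = sym (+-identityʳ (π 0))
line-path {n} π path (suc k) = begin
  π (suc k)        ≡⟨ path k ⟩
  suc (π k)        ≡⟨ cong suc (line-path {n} π path k) ⟩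
  suc (π 0 + k)    ≡⟨ sym (+-suc (π 0) k) ⟩
  π 0 + suc k      ∎
  where open ≡-Reasoning

line-acyclic : ∀ {n} (π : ℕ → ℕ) → IsPath (line {n}) π → ¬ IsCycle (line {n}) π
line-acyclic {n} π path cycle =
  let j , 0<j , πⱼ≡π₀ = cycle 0
  in <-irrefl (sym (trans (sym (line-path {n} π path j)) πⱼ≡π₀)) (m<m+n (π 0) 0<j)

hasCycle : SF (suc n)
hasCycle = Ec (st (atom zero))

loop⊨hasCycle : ∀ {n} → loop {suc n} ⊨ hasCycle {n}
loop⊨hasCycle = (λ _ → tt) , refl , (λ _ → tt) , (λ i → suc i , ≤-refl , refl) , refl

line⊭hasCycle : ∀ {n} → ¬ line {suc n} ⊨ hasCycle {n}
line⊭hasCycle {n} (π , _ , path , cycle , _) = line-acyclic {suc n} π path cycle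

hasCycle-not-CTL* : ∀ {n} (ψ : SF (suc n)) → IsCTL*ₛ ψ → ¬ Equiv (hasCycle {n}) ψ
hasCycle-not-CTL* {n} ψ ψ∈CTL* =
  preserved⇒¬Equiv {φ = hasCycle} (loop⊨hasCycle {n}) (line⊭hasCycle {n})
    (ctl*-bisim-invariantₛ loop∼line ψ ψ∈CTL* tt)

hasCycle-not-μ : ∀ {n} (χ : MuF (suc n) 0) → ¬ EquivMu (hasCycle {n}) χ
hasCycle-not-μ {n} χ =
  preserved⇒¬EquivMu {φ = hasCycle} (loop⊨hasCycle {n}) (line⊭hasCycle {n})
    (μ-bisim-invariant loop∼line χ (λ ()) tt)

isZero : ℕ → Bool
isZero zero    = true
isZero (suc _) = false

countdown : ∀ {n} → ℕ → Kripke n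
countdown m = record
  { W = ℕ ; R = λ a b → b ≡ pred a ; L = λ a _ → isZero a ; wI = m
  ; enc = λ a → a ; enc-inj = λ _ _ e → e ; total = λ a → pred a , refl }

CountsDown : (ℕ → ℕ) → Set
CountsDown π = ∀ i → π (suc i) ≡ pred (π i)

countsDown-∸ : ∀ π → CountsDown π → ∀ i k → π (i + k) ≡ π i ∸ k
countsDown-∸ π down i zero    = cong π (+-identityʳ i)
countsDown-∸ π down i (suc k) = begin
  π (i + suc k)      ≡⟨ cong π (+-suc i k) ⟩
  π (suc (i + k))    ≡⟨ down (i + k) ⟩
  pred (π (i + k))   ≡⟨ cong pred (countsDown-∸ π down i k) ⟩
  pred (π i ∸ k)     ≡⟨ pred[m∸n]≡m∸[1+n] (π i) k ⟩
  π i ∸ suc k        ∎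
  where open ≡-Reasoning

∸-countsDown : ∀ a → CountsDown (a ∸_)
∸-countsDown a i = sym (pred[m∸n]≡m∸[1+n] a i)

∸-fixed⇒0 : ∀ a {j} → 0 < j → a ∸ j ≡ a → a ≡ 0
∸-fixed⇒0 zero    _       _ = refl
∸-fixed⇒0 (suc a) {suc j} _ e = ⊥-elim (<-irrefl refl (subst (_≤ a) e (m∸n≤m a j)))

countsDown-return⇒0 : ∀ π → CountsDown π → Σ ℕ (λ j → 0 < j × π j ≡ π 0) → π 0 ≡ 0
countsDown-return⇒0 π down (j , 0<j , πⱼ≡π₀) =
  ∸-fixed⇒0 (π 0) 0<j (trans (sym (countsDown-∸ π down 0 j)) πⱼ≡π₀)

mutual
  nextDepthₛ : SF n → ℕ
  nextDepthₛ (atom p) = 0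
  nextDepthₛ (¬ₛ φ)   = nextDepthₛ φ
  nextDepthₛ (φ ∧ₛ ψ) = nextDepthₛ φ ⊔ nextDepthₛ ψ
  nextDepthₛ (φ ∨ₛ ψ) = nextDepthₛ φ ⊔ nextDepthₛ ψ
  nextDepthₛ (E ψ)    = nextDepthₚ ψ
  nextDepthₛ (A ψ)    = nextDepthₚ ψ
  nextDepthₛ (Ec ψ)   = nextDepthₚ ψ
  nextDepthₛ (Ac ψ)   = nextDepthₚ ψ

  nextDepthₚ : PF n → ℕ
  nextDepthₚ (st φ)   = nextDepthₛ φ
  nextDepthₚ (¬ₚ ψ)   = nextDepthₚ ψ
  nextDepthₚ (ψ ∧ₚ χ) = nextDepthₚ ψ ⊔ nextDepthₚ χ
  nextDepthₚ (ψ ∨ₚ χ) = nextDepthₚ ψ ⊔ nextDepthₚ χ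
  nextDepthₚ (X ψ)    = suc (nextDepthₚ ψ)
  nextDepthₚ (ψ U χ)  = nextDepthₚ ψ ⊔ nextDepthₚ χ

Close : ℕ → ℕ → ℕ → Set
Close d a b = a ≡ b ⊎ (d < a × d < b)

close-sym : ∀ {d a b} → Close d a b → Close d b a
close-sym (inj₁ a≡b)        = inj₁ (sym a≡b)
close-sym (inj₂ (d<a , d<b)) = inj₂ (d<b , d<a)

close-pred : ∀ {d a b} → Close (suc d) a b → Close d (pred a) (pred b)
close-pred (inj₁ a≡b)                = inj₁ (cong pred a≡b)
close-pred (inj₂ (s≤s d<a , s≤s d<b)) = inj₂ (d<a , d<b)

close-0⇒≡ : ∀ {d a b} → Close d a b → a ≡ 0 → a ≡ b
close-0⇒≡ (inj₁ a≡b)      _    = a≡b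
close-0⇒≡ (inj₂ (() , _)) refl

Until : (ℕ → Set) → (ℕ → Set) → Set
Until P Q = Σ ℕ λ k → Q k × (∀ j → j < k → P j)

-- If Q is met above d, b itself serves; otherwise b counts down to the same world t, passing
-- only worlds above d (which behave like a) or worlds that a also passes on its way to t.
until-transfer : ∀ {d a b} {P Q P′ Q′ : ℕ → Set} → Close d a b →
                 (∀ {j j′} → Close d (a ∸ j) (b ∸ j′) → P j → P′ j′) →
                 (∀ {j j′} → Close d (a ∸ j) (b ∸ j′) → Q j → Q′ j′) →
                 Until P Q → Until P′ Q′
until-transfer (inj₁ refl) P⇒P′ Q⇒Q′ (k , q , before) =
  k , Q⇒Q′ (inj₁ refl) q , λ j j<k → P⇒P′ (inj₁ refl) (before j j<k)
until-transfer {d} {a} {b} {P′ = P′} (inj₂ (d<a , d<b)) P⇒P′ Q⇒Q′ (k , q , before) with d <? a ∸ k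
... | yes d<t = 0 , Q⇒Q′ (inj₂ (d<t , d<b)) q , λ _ ()
... | no d≮t = b ∸ t , Q⇒Q′ (inj₁ (sym (m∸[m∸n]≡n t≤b))) q , before′
  where
  t : ℕ
  t = a ∸ k
  t≤d : t ≤ d
  t≤d = ≮⇒≥ d≮t
  t≤b : t ≤ b
  t≤b = ≤-trans t≤d (<⇒≤ d<b)
  before′ : ∀ j′ → j′ < b ∸ t → P′ j′
  before′ j′ j′<b∸t with d <? b ∸ j′
  ... | yes d<v = P⇒P′ (inj₂ (d<a , d<v)) (before 0 (∸-cancelʳ-< (≤-<-trans t≤d d<a)))
  ... | no d≮v = P⇒P′ (inj₁ a∸j≡v) (before (a ∸ v) (∸-cancelʳ-< t<a∸j))
    where
    v : ℕ
    v = b ∸ j′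
    v≤a : v ≤ a
    v≤a = ≤-trans (≮⇒≥ d≮v) (<⇒≤ d<a)
    a∸j≡v : a ∸ (a ∸ v) ≡ v
    a∸j≡v = m∸[m∸n]≡n v≤a
    t<a∸j : t < a ∸ (a ∸ v)
    t<a∸j = begin-strict
      t             ≡⟨ m∸[m∸n]≡n t≤b ⟨
      b ∸ (b ∸ t)   <⟨ ∸-monoʳ-< j′<b∸t (m∸n≤m b t) ⟩
      v             ≡⟨ a∸j≡v ⟨
      a ∸ (a ∸ v)   ∎
      where open ≤-Reasoning

mutual
  close-transferₛ : ∀ {n m m′ d} (φ : SF n) → nextDepthₛ φ ≤ d → ∀ {a b} → Close d a b →
                    satS (countdown m) a φ → satS (countdown m′) b φ
  close-transferₛ (atom p) _ (inj₁ refl)        h = h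
  close-transferₛ (atom p) _ (inj₂ (s≤s _ , _)) ()
  close-transferₛ (¬ₛ φ) φ≤d c h h′ =
    h (close-transferₛ φ φ≤d (close-sym c) h′)
  close-transferₛ (φ ∧ₛ ψ) φψ≤d c (h , h′) =
      close-transferₛ φ (m⊔n≤o⇒m≤o _ _ φψ≤d) c h
    , close-transferₛ ψ (m⊔n≤o⇒n≤o _ _ φψ≤d) c h′
  close-transferₛ (φ ∨ₛ ψ) φψ≤d c (inj₁ h) =
    inj₁ (close-transferₛ φ (m⊔n≤o⇒m≤o _ _ φψ≤d) c h)
  close-transferₛ (φ ∨ₛ ψ) φψ≤d c (inj₂ h) =
    inj₂ (close-transferₛ ψ (m⊔n≤o⇒n≤o _ _ φψ≤d) c h)
  close-transferₛ (E ψ) ψ≤d {b = b} c (π , refl , path , h) =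
    (b ∸_) , refl , ∸-countsDown b , close-transferₚ ψ ψ≤d π (b ∸_) path (∸-countsDown b) c h
  close-transferₛ (A ψ) ψ≤d {a} c h π′ refl path′ =
    close-transferₚ ψ ψ≤d (a ∸_) π′ (∸-countsDown a) path′ c (h (a ∸_) refl (∸-countsDown a))
  close-transferₛ (Ec ψ) ψ≤d c (π , refl , path , cycle , h) =
    π , close-0⇒≡ c (countsDown-return⇒0 π path (cycle 0)) , path , cycle
    , close-transferₚ ψ ψ≤d π π path path (inj₁ refl) h
  close-transferₛ (Ac ψ) ψ≤d c h π′ refl path′ cycle′ =
    close-transferₚ ψ ψ≤d π′ π′ path′ path′ (inj₁ refl)
      (h π′ (close-0⇒≡ (close-sym c) (countsDown-return⇒0 π′ path′ (cycle′ 0))) path′ cycle′)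

  close-transferₚ : ∀ {n m m′ d} (ψ : PF n) → nextDepthₚ ψ ≤ d → (π π′ : ℕ → ℕ) →
                    CountsDown π → CountsDown π′ →
                    ∀ {i i′} → Close d (π i) (π′ i′) →
                    satP (countdown m) π i ψ → satP (countdown m′) π′ i′ ψ
  close-transferₚ (st φ) φ≤d π π′ path path′ c h = close-transferₛ φ φ≤d c h
  close-transferₚ (¬ₚ ψ) ψ≤d π π′ path path′ c h h′ =
    h (close-transferₚ ψ ψ≤d π′ π path′ path (close-sym c) h′)
  close-transferₚ (ψ ∧ₚ χ) ψχ≤d π π′ path path′ c (h , h′) =
      close-transferₚ ψ (m⊔n≤o⇒m≤o _ _ ψχ≤d) π π′ path path′ c h
    , close-transferₚ χ (m⊔n≤o⇒n≤o _ _ ψχ≤d) π π′ path path′ c h′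
  close-transferₚ (ψ ∨ₚ χ) ψχ≤d π π′ path path′ c (inj₁ h) =
    inj₁ (close-transferₚ ψ (m⊔n≤o⇒m≤o _ _ ψχ≤d) π π′ path path′ c h)
  close-transferₚ (ψ ∨ₚ χ) ψχ≤d π π′ path path′ c (inj₂ h) =
    inj₂ (close-transferₚ χ (m⊔n≤o⇒n≤o _ _ ψχ≤d) π π′ path path′ c h)
  close-transferₚ {d = suc d} (X ψ) (s≤s ψ≤d) π π′ path path′ {i} {i′} c h =
    close-transferₚ ψ ψ≤d π π′ path path′
      (subst₂ (Close d) (sym (path i)) (sym (path′ i′)) (close-pred c)) h
  close-transferₚ {n} {m} {m′} {d} (ψ U χ) ψχ≤d π π′ path path′ {i} {i′} c =
    until-transfer c (along ψ (m⊔n≤o⇒m≤o _ _ ψχ≤d)) (along χ (m⊔n≤o⇒n≤o _ _ ψχ≤d))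
    where
    along : (ψ : PF n) → nextDepthₚ ψ ≤ d → ∀ {j j′} → Close d (π i ∸ j) (π′ i′ ∸ j′) →
            satP (countdown m) π (i + j) ψ → satP (countdown m′) π′ (i′ + j′) ψ
    along ψ ψ≤d {j} {j′} c′ = close-transferₚ ψ ψ≤d π π′ path path′
      (subst₂ (Close d) (sym (countsDown-∸ π path i j)) (sym (countsDown-∸ π′ path′ i′ j′)) c′)

data Even : ℕ → Set where
  zero : Even 0
  suc-suc : ∀ {k} → Even k → Even (suc (suc k))

Even-double : ∀ k → Even (k + k)
Even-double zero    = zero
Even-double (suc k) = subst (λ l → Even (suc l)) (sym (+-suc k k)) (suc-suc (Even-double k))

Even⇒¬Even-suc : ∀ {k} → Even k → ¬ Even (suc k)
Even⇒¬Even-suc (suc-suc e) (suc-suc e′) = Even⇒¬Even-suc e e′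

evenDistanceStep : MuF (suc n) 1
evenDistanceStep = atom zero ∨μ (natom zero ∧μ box (natom zero ∧μ box (var zero)))

evenDistance : MuF (suc n) 0
evenDistance = μ evenDistanceStep

Even⇒evenDistance : ∀ {n m a} → Even a → ⟦ evenDistance {n} ⟧ (countdown m) (λ ()) a
Even⇒evenDistance e S prefixed = lift (below e)
  where
  below : ∀ {k} → Even k → S k
  below zero        = lower (prefixed 0 (inj₁ (lift refl)))
  below (suc-suc e) = lower (prefixed _
    (inj₂ (lift (λ ()) , λ { _ refl → lift (λ ()) , λ { _ refl → lift (below e) } })))

-- Even is a prefixed point, so it contains the least fixpoint.
evenDistance⇒Even : ∀ {n m a} → ⟦ evenDistance {n} ⟧ (countdown m) (λ ()) a → Even a
evenDistance⇒Even {n} {m} h = lower (h Even prefixed)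
  where
  prefixed : ∀ v → ⟦ evenDistanceStep ⟧ (countdown {suc n} m) (extend Even (λ ())) v → Lift _ (Even v)
  prefixed zero          _                 = lift zero
  prefixed (suc zero)    (inj₂ (_ , step)) = ⊥-elim (lower (proj₁ (step 0 refl)) refl)
  prefixed (suc (suc v)) (inj₂ (_ , step)) = lift (suc-suc (lower (proj₂ (step (suc v) refl) v refl)))

evenDistance-not-CTL*CD : ∀ {n} (φ : SF (suc n)) → ¬ EquivMu φ evenDistance
evenDistance-not-CTL*CD {n} φ =
  preservedMu⇒¬EquivMu {χ = evenDistance}
    (Even⇒evenDistance {n} {e} (Even-double (suc d)))
    (λ h → Even⇒¬Even-suc (Even-double (suc d)) (evenDistance⇒Even {n} {suc e} h))
    (close-transferₛ φ ≤-refl (inj₂ (d<e , m<n⇒m<1+n d<e)))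
  where
  d e : ℕ
  d = nextDepthₛ φ
  e = suc d + suc d
  d<e : d < e
  d<e = m≤m+n (suc d) (suc d)

mainTheorem6 : (n : ℕ) →
    ((φ : SF (suc n)) → IsCTL*ₛ φ → Σ (SF (suc n)) (λ ψ → Equiv φ ψ))
    × Σ (SF (suc n)) (λ φ → (ψ : SF (suc n)) → IsCTL*ₛ ψ → ¬ Equiv φ ψ)
    × Σ (SF (suc n)) (λ φ → (χ : MuF (suc n) 0) → ¬ EquivMu φ χ)
    × Σ (MuF (suc n) 0) (λ χ → (φ : SF (suc n)) → ¬ EquivMu φ χ)
mainTheorem6 n =
    (λ φ _ → φ , λ _ → ⇔-refl)
  , (hasCycle , hasCycle-not-CTL*)
  , (hasCycle , hasCycle-not-μ)
  , (evenDistance , evenDistance-not-CTL*CD)
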